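{- Let $(G,\Lambda,t)$ be a $\tau$-bounded instance of the generalized list $T$-coloring problem, where $G=(V,E)$ has $n$ vertices ordered as $v_1,\dots,v_n$, and $\tau\ge 1$ is an integer. For every integer $k\ge 1$ we have $\overline{T[k]\oplus P}^{(k)}=T[k+1]$.
   Context: An instance of the generalized list $T$-coloring problem is a triple $(G,\Lambda,t)$, where $G=(V,E)$ is a finite graph, $\Lambda\colon V\to 2^{\mathbb N}$ assigns to every vertex a finite list of permitted labels, and $t\colon E\to 2^{\mathbb N\cup\{0\}}$ assigns to every edge a set of forbidden differences, with $0\in t(e)$ for all $e\in E$. A (partial) labeling $\varphi$ defined on a subset of $V$ is proper if $\varphi(v)\in\Lambda(v)$ for each labeled $v$ and $|\varphi(v)-\varphi(w)|\notin t(vw)$ for every edge $vw$ with both ends labeled. The instance is $\tau$-bounded if $\max\bigcup_{e\in E}t(e)\le\tau$. For a proper partial labeling $\varphi$ with values in $\{1,\dots,k\}$ and a vertex $v$, let $\Gamma_\varphi(v)$ be true iff $k+1\in\Lambda(v)$ and there is no labeled $w\in N(v)$ with $(k+1)-\varphi(w)\in t(vw)$. Let $[\tau+1]=\{0,1,\dots,\tau+1\}$ and $\llbracket\tau+1\rrbracket=[\tau+1]\cup\{\bar 0\}$, where $\bar 0$ is an extra symbol. For $k\ge1$, $T[k]\subseteq\llbracket\tau+1\rrbracket^n$ is the set of vectors $\mathbf a$ for which there is a proper partial labeling $\varphi$ with values in $\{1,\dots,k\}$ such that for every $i$: $\mathbf a_i=0$ iff $v_i$ is unlabeled and $\Gamma_\varphi(v_i)$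 is true; $\mathbf a_i=\bar0$ iff $v_i$ is unlabeled and $\Gamma_\varphi(v_i)$ is false; $\mathbf a_i=1$ iff $\varphi(v_i)\le k-\tau$; $\mathbf a_i=j$ iff $\varphi(v_i)=k+j-\tau-1$, for $j\in\{2,\dots,\tau+1\}$. Define the partial operation $\oplus\colon\llbracket\tau+1\rrbracket\times\{0,1\}\to[\tau+1]$: $x\oplus0=0$ if $x\in\{0,\bar0\}$; $x\oplus 0=1$ if $x\in\{1,2\}$; $x\oplus0=x-1$ if $x\in\{3,\dots,\tau+1\}$; $0\oplus1=\tau+1$; undefined otherwise. Extend it coordinatewise to vectors (the result is undefined if some coordinate is undefined), and for $A\subseteq\llbracket\tau+1\rrbracket^n$, $B\subseteq\{0,1\}^n$ let $A\oplus B=\{\mathbf a\oplus\mathbf b:\mathbf a\in A,\mathbf b\in B,\ \mathbf a\oplus\mathbf b\text{ defined}\}$. Let $P\subseteq\{0,1\}^n$ be the set of characteristic vectors (with respect to the ordering $v_1,\dots,v_n$) of all independent sets of $G$. For $\mathbf b\in[\tau+1]^n$ define $\overline{\mathbf b}^{(k)}\in\llbracket\tau+1\rrbracket^n$ by: $\overline{\mathbf b}^{(k)}_i=0$ if $\mathbf b_i=0$, $k+2\in\Lambda(v_i)$ and there is no $v_j\in N(v_i)$ with $\tau-\mathbf b_j+2\in t(v_iv_j)$; $\overline{\mathbf b}^{(k)}_i=\bar0$ if $\mathbf b_i=0$ and ($k+2\notin\Lambda(v_i)$ or some $v_j\in N(v_i)$ has $\tau-\mathbf b_j+2\in t(v_iv_j)$);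 $\overline{\mathbf b}^{(k)}_i=\mathbf b_i$ if $\mathbf b_i\in\{1,\dots,\tau+1\}$. For a set $B$ of such vectors, $\overline B^{(k)}=\{\overline{\mathbf b}^{(k)}:\mathbf b\in B\}$. -}

module Defs where

open import Data.Nat using (ℕ; zero; suc; _+_; _∸_; _≤_; ∣_-_∣)
open import Data.Bool using (Bool; true; false)
open import Data.Fin using (Fin; zero; suc; toℕ; fromℕ; inject₁)
open import Data.Vec using (Vec; lookup)
open import Data.List using (List)
open import Data.List.Membership.Propositional using (_∈_; _∉_)
open import Data.Maybe using (Maybe; just; nothing)
open import Data.Product using (Σ; ∃; ∃-syntax; _×_; _,_)
open import Data.Sum using (_⊎_)
open import Data.Empty using (⊥)
open import Relation.Nullary using (¬_)
open import Relation.Binary.PropositionalEquality using (_≡_; _≢_)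
open import Function using (_⇔_)

-- G is a finite simple graph given by a symmetric irreflexive adjacency
-- relation; Λ(v) is a finite list of permitted labels; t(vw) is a finite
-- list of forbidden differences (only meaningful on edges), symmetric in
-- v,w and containing 0 on every edge.

record Instance (n : ℕ) : Set where
  field
    adj     : Fin n → Fin n → Bool
    adj-sym : ∀ i j → adj i j ≡ adj j i
    adj-irr : ∀ i → adj i i ≡ false
    Λ       : Fin n → List ℕ
    t       : Fin n → Fin n → List ℕ
    t-sym   : ∀ i j → t i j ≡ t j i
    t-zero  : ∀ i j → adj i j ≡ true → 0 ∈ t i j

Bounded : ∀ {n} → ℕ → Instance n → Set
Bounded {n} τ I = ∀ (i j : Fin n) → adj i j ≡ true → ∀ x → x ∈ t i j → x ≤ τ
  where open Instance I

-- Partial labelings: φ i ≡ nothing means v_i is unlabeled.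

PartialLabeling : ℕ → Set
PartialLabeling n = Fin n → Maybe ℕ

module _ {n : ℕ} (I : Instance n) where
  open Instance I

  Proper : PartialLabeling n → Set
  Proper φ =
    (∀ i x → φ i ≡ just x → x ∈ Λ i) ×
    (∀ i j x y → adj i j ≡ true → φ i ≡ just x → φ j ≡ just y → ∣ x - y ∣ ∉ t i j)

  ValuesIn : ℕ → PartialLabeling n → Set
  ValuesIn k φ = ∀ i x → φ i ≡ just x → (1 ≤ x × x ≤ k)

  Γ : ℕ → PartialLabeling n → Fin n → Set
  Γ k φ v = (suc k ∈ Λ v) ×
            ¬ (∃[ w ] ∃[ x ] (adj v w ≡ true × φ w ≡ just x × (suc k ∸ x) ∈ t v w))

-- The alphabet ⟦τ+1⟧ = {0,1,…,τ+1} ∪ {0̄}; [τ+1] is Fin (τ + 2).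

data Letter (τ : ℕ) : Set where
  num  : Fin (suc (suc τ)) → Letter τ
  bar0 : Letter τ

module _ {n : ℕ} (I : Instance n) (τ : ℕ) where
  open Instance I

  -- T[k] ⊆ ⟦τ+1⟧^n   (the equation  φ(v_i) = k + j − τ − 1  is written
  -- additively as φ(v_i) + τ + 1 = k + j, and φ(v_i) ≤ k − τ as
  -- φ(v_i) + τ ≤ k, to avoid truncated subtraction)
  T : ℕ → Vec (Letter τ) n → Set
  T k a = ∃[ φ ] (Proper I φ × ValuesIn I k φ × (∀ i →
      ((lookup a i ≡ num zero) ⇔ (φ i ≡ nothing × Γ I k φ i)) ×
      ((lookup a i ≡ bar0) ⇔ (φ i ≡ nothing × ¬ Γ I k φ i)) ×
      ((lookup a i ≡ num (suc zero)) ⇔ (∃[ x ] (φ i ≡ just x × x + τ ≤ k))) ×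
      (∀ (j : Fin (suc (suc τ))) → 2 ≤ toℕ j →
         ((lookup a i ≡ num j) ⇔ (∃[ x ] (φ i ≡ just x × x + τ + 1 ≡ k + toℕ j))))))

  P : Vec Bool n → Set
  P b = ∀ i j → adj i j ≡ true → lookup b i ≡ true → lookup b j ≡ true → ⊥

-- the partial operation ⊕ : ⟦τ+1⟧ × {0,1} → [τ+1]
-- (x ⊕ 0 = x − 1 for 3 ≤ x ≤ τ+1 and 2 ⊕ 0 = 1 are both given by the
--  third clause: x = j + 2 ↦ j + 1)
_⊕_ : ∀ {τ} → Letter τ → Bool → Maybe (Fin (suc (suc τ)))
bar0                  ⊕ false = just zero
num zero              ⊕ false = just zero
num (suc zero)        ⊕ false = just (suc zero)
num (suc (suc j))     ⊕ false = just (inject₁ (suc j))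
_⊕_ {τ} (num zero)    true    = just (fromℕ (suc τ))
num (suc _)           ⊕ true  = nothing
bar0                  ⊕ true  = nothing

_⊕ˢ_ : ∀ {τ n} → (Vec (Letter τ) n → Set) → (Vec Bool n → Set) →
       Vec (Fin (suc (suc τ))) n → Set
(A ⊕ˢ B) c = ∃[ a ] ∃[ b ] (A a × B b × (∀ i → (lookup a i ⊕ lookup b i) ≡ just (lookup c i)))

module _ {n : ℕ} (I : Instance n) (τ : ℕ) where
  open Instance I

  IsBar : ℕ → Vec (Fin (suc (suc τ))) n → Vec (Letter τ) n → Set
  IsBar k b c = ∀ i →
      (lookup b i ≡ zero × suc (suc k) ∈ Λ i ×
         ¬ (∃[ j ] (adj i j ≡ true × ((τ + 2) ∸ toℕ (lookup b j)) ∈ t i j)) ×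
         lookup c i ≡ num zero)
    ⊎ (lookup b i ≡ zero ×
         (suc (suc k) ∉ Λ i ⊎ ∃[ j ] (adj i j ≡ true × ((τ + 2) ∸ toℕ (lookup b j)) ∈ t i j)) ×
         lookup c i ≡ bar0)
    ⊎ (lookup b i ≢ zero × lookup c i ≡ num (lookup b i))

  Bar : ℕ → (Vec (Fin (suc (suc τ))) n → Set) → Vec (Letter τ) n → Set
  Bar k B c = ∃[ b ] (B b × IsBar k b c)

module Submission where

-- A vertex's letter at level K records its label only through a digit: 0 if unlabeled, 1 if the
-- label is at most K − τ, and the offset j of the label K + j − τ − 1 otherwise. Passing from k to
-- k + 1 either shifts this digit down (⊕ 0) or, on an independent set of free vertices, assigns
-- the new label k + 1 (⊕ 1, digit τ + 1); conversely every labeling at level k + 1 splits into its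
-- labels ≤ k and the independent set labelled k + 1. The one thing not visible in the digits is
-- Γ at level k + 1, and τ-boundedness recovers it: a neighbour labelled x can forbid k + 2 only if
-- k + 2 − x ≤ τ, so x is a recent label, and then k + 2 − x = τ + 2 − b_j is read off its digit.
-- This is exactly the case distinction of the bar operation.

open import Defs
open import Data.Nat using (ℕ; zero; suc; _+_; _∸_; _≤_; _<_; s≤s; z≤n; _≟_; _≤?_; ∣_-_∣)
open import Data.Nat.Properties
open import Data.Bool using (Bool; true; false; if_then_else_)
import Data.Bool.Properties as Bool
open import Data.Fin using (Fin; zero; suc; toℕ; fromℕ; lower₁)
open import Data.Fin.Properties using (toℕ-injective; toℕ-fromℕ; toℕ-inject₁; toℕ-lower₁; inject₁-lower₁; any?)
open import Data.Vec using (Vec; lookup; tabulate)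
open import Data.Vec.Properties using (lookup∘tabulate)
open import Data.List.Membership.Propositional using (_∈_; _∉_)
open import Data.List.Membership.DecPropositional _≟_ using (_∈?_)
open import Data.Maybe using (Maybe; just; nothing)
open import Data.Maybe.Properties using (just-injective)
open import Data.Product using (∃-syntax; _×_; _,_; proj₁; proj₂)
open import Data.Sum using (_⊎_; inj₁; inj₂; [_,_])
open import Data.Empty using (⊥; ⊥-elim)
open import Relation.Nullary using (¬_; Dec; yes; no)
open import Relation.Nullary.Decidable using (_×-dec_; ¬?; map′)
open import Relation.Binary.PropositionalEquality using (_≡_; _≢_; refl; sym; trans; cong; cong₂; subst; subst₂; module ≡-Reasoning)
open import Function using (_⇔_; _∘_; case_of_)
open import Function.Bundles using (mk⇔; Equivalence)

open Equivalence using (to; from)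

module Encoding {n : ℕ} (I : Instance n) (τ : ℕ) where
  open Instance I

  data Digit (K : ℕ) : Maybe ℕ → Fin (suc (suc τ)) → Set where
    unlabeled : Digit K nothing zero
    old       : ∀ {x} → x + τ ≤ K → Digit K (just x) (suc zero)
    recent    : ∀ {x j} → 2 ≤ toℕ j → x + τ + 1 ≡ K + toℕ j → Digit K (just x) j

  old-not-recent : ∀ {x K a} → x + τ ≤ K → x + τ + 1 ≡ K + a → 2 ≤ a → ⊥
  old-not-recent {x} {K} {a} x+τ≤K eq 2≤a = 1+n≰n (+-cancelˡ-≤ K 2 1 (begin
    K + 2      ≤⟨ +-monoʳ-≤ K 2≤a ⟩
    K + a      ≡⟨ eq ⟨
    x + τ + 1  ≤⟨ +-monoˡ-≤ 1 x+τ≤K ⟩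
    K + 1      ∎))
    where open ≤-Reasoning

  digit-functional : ∀ {K m f g} → Digit K m f → Digit K m g → f ≡ g
  digit-functional unlabeled     unlabeled       = refl
  digit-functional (old _)       (old _)         = refl
  digit-functional (old le)      (recent h eq)   = ⊥-elim (old-not-recent le eq h)
  digit-functional (recent h eq) (old le)        = ⊥-elim (old-not-recent le eq h)
  digit-functional {K} (recent _ eq) (recent _ eq′) =
    toℕ-injective (+-cancelˡ-≡ K _ _ (trans (sym eq) eq′))

  digit-just-nonzero : ∀ {K x f} → Digit K (just x) f → f ≢ zero
  digit-just-nonzero (recent () _) refl

  unlabeled⇒digit-zero : ∀ {K m f} → m ≡ nothing → Digit K m f → f ≡ zero
  unlabeled⇒digit-zero refl unlabeled = refl

  digit-zero⇒unlabeled : ∀ {K m f} → Digit K m f → f ≡ zero → m ≡ nothing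
  digit-zero⇒unlabeled unlabeled      _ = refl
  digit-zero⇒unlabeled (recent () _) refl

  digit-one : ∀ {K x} → Digit K (just x) (suc zero) ⇔ x + τ ≤ K
  digit-one = mk⇔ (λ { (old le) → le ; (recent (s≤s ()) _) }) old

  digit-high : ∀ {K x j} → 2 ≤ toℕ j → Digit K (just x) j ⇔ x + τ + 1 ≡ K + toℕ j
  digit-high h = mk⇔ (recent-eq h) (recent h)
    where
    recent-eq : ∀ {K x j} → 2 ≤ toℕ j → Digit K (just x) j → x + τ + 1 ≡ K + toℕ j
    recent-eq (s≤s ()) (old _)
    recent-eq _        (recent _ eq) = eq

  data Encodes (K : ℕ) (φ : PartialLabeling n) (i : Fin n) : Letter τ → Set where
    free    : φ i ≡ nothing → Γ I K φ i → Encodes K φ i (num zero)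
    blocked : φ i ≡ nothing → ¬ Γ I K φ i → Encodes K φ i bar0
    labeled : ∀ {x f} → φ i ≡ just x → Digit K (just x) f → Encodes K φ i (num f)

  LetterSpec : ℕ → PartialLabeling n → Fin n → Letter τ → Set
  LetterSpec K φ i l =
      ((l ≡ num zero) ⇔ (φ i ≡ nothing × Γ I K φ i)) ×
      ((l ≡ bar0) ⇔ (φ i ≡ nothing × ¬ Γ I K φ i)) ×
      ((l ≡ num (suc zero)) ⇔ (∃[ x ] (φ i ≡ just x × x + τ ≤ K))) ×
      (∀ (j : Fin (suc (suc τ))) → 2 ≤ toℕ j →
         ((l ≡ num j) ⇔ (∃[ x ] (φ i ≡ just x × x + τ + 1 ≡ K + toℕ j))))

  private
    nothing≢just : ∀ {m : Maybe ℕ} {x} → m ≡ nothing → m ≡ just x → ⊥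
    nothing≢just refl ()

    num-injective : ∀ {f g} → num {τ} f ≡ num g → f ≡ g
    num-injective refl = refl

  encodes-zero : ∀ {K φ i l} → Encodes K φ i l → (l ≡ num zero) ⇔ (φ i ≡ nothing × Γ I K φ i)
  encodes-zero (free e γ)    = mk⇔ (λ _ → e , γ) (λ _ → refl)
  encodes-zero (blocked e ¬γ) = mk⇔ (λ ()) (λ (_ , γ) → ⊥-elim (¬γ γ))
  encodes-zero (labeled e d) =
    mk⇔ (λ eq → ⊥-elim (digit-just-nonzero d (num-injective eq)))
        (λ (e′ , _) → ⊥-elim (nothing≢just e′ e))

  encodes-bar0 : ∀ {K φ i l} → Encodes K φ i l → (l ≡ bar0) ⇔ (φ i ≡ nothing × ¬ Γ I K φ i)
  encodes-bar0 (free e γ)     = mk⇔ (λ ()) (λ (_ , ¬γ) → ⊥-elim (¬γ γ))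
  encodes-bar0 (blocked e ¬γ) = mk⇔ (λ _ → e , ¬γ) (λ _ → refl)
  encodes-bar0 (labeled e d)  = mk⇔ (λ ()) (λ (e′ , _) → ⊥-elim (nothing≢just e′ e))

  encodes-num : ∀ {K φ i l f} (Q : ℕ → Set) → Encodes K φ i l → f ≢ zero →
    (∀ {x} → Digit K (just x) f ⇔ Q x) → (l ≡ num f) ⇔ (∃[ x ] (φ i ≡ just x × Q x))
  encodes-num Q (free e _) f≢0 _ =
    mk⇔ (λ eq → ⊥-elim (f≢0 (sym (num-injective eq))))
        (λ (_ , e′ , _) → ⊥-elim (nothing≢just e e′))
  encodes-num Q (blocked e _) _ _ = mk⇔ (λ ()) (λ (_ , e′ , _) → ⊥-elim (nothing≢just e e′))
  encodes-num {K} Q (labeled {x} e d) _ digit⇔Q = mk⇔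
    (λ eq → x , e , to digit⇔Q (subst (Digit K (just x)) (num-injective eq) d))
    (λ (y , e′ , q) → cong num (digit-functional d
       (subst (λ z → Digit K (just z) _) (just-injective (trans (sym e′) e)) (from digit⇔Q q))))

  encodes⇒spec : ∀ {K φ i l} → Encodes K φ i l → LetterSpec K φ i l
  encodes⇒spec {K} enc =
    encodes-zero enc , encodes-bar0 enc ,
    encodes-num (λ x → x + τ ≤ K) enc (λ ()) digit-one ,
    λ j h → encodes-num (λ x → x + τ + 1 ≡ K + toℕ j) enc (high≢zero h) (digit-high h)
    where
    high≢zero : ∀ {j : Fin (suc (suc τ))} → 2 ≤ toℕ j → j ≢ zero
    high≢zero () refl

  spec⇒encodes : ∀ {K φ i} l → LetterSpec K φ i l → Encodes K φ i l
  spec⇒encodes (num zero) (s₀ , _) = let (e , γ) = to s₀ refl in free e γ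
  spec⇒encodes bar0 (_ , s̄ , _) = let (e , ¬γ) = to s̄ refl in blocked e ¬γ
  spec⇒encodes (num (suc zero)) (_ , _ , s₁ , _) =
    let (_ , e , le) = to s₁ refl in labeled e (old le)
  spec⇒encodes (num j@(suc (suc _))) (_ , _ , _ , sⱼ) =
    let (_ , e , eq) = to (sⱼ j (s≤s (s≤s z≤n))) refl in labeled e (recent (s≤s (s≤s z≤n)) eq)

  Encoded : ℕ → Vec (Letter τ) n → Set
  Encoded K a = ∃[ φ ] (Proper I φ × ValuesIn I K φ × (∀ i → Encodes K φ i (lookup a i)))

  T⇔Encoded : ∀ {K a} → T I τ K a ⇔ Encoded K a
  T⇔Encoded = mk⇔
    (λ (φ , Pφ , Vφ , spec) → φ , Pφ , Vφ , λ i → spec⇒encodes _ (spec i))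
    (λ (φ , Pφ , Vφ , enc) → φ , Pφ , Vφ , λ i → encodes⇒spec (enc i))

  digitOf : Letter τ → Fin (suc (suc τ))
  digitOf (num f) = f
  digitOf bar0    = zero

  encodes⇒digit : ∀ {K φ i l} → Encodes K φ i l → Digit K (φ i) (digitOf l)
  encodes⇒digit (free e _)    rewrite e = unlabeled
  encodes⇒digit (blocked e _) rewrite e = unlabeled
  encodes⇒digit (labeled e d) rewrite e = d

  digit⇒encodes : ∀ {K φ i m f} → φ i ≡ m → Digit K m f → f ≢ zero → Encodes K φ i (num f)
  digit⇒encodes e unlabeled   f≢0 = ⊥-elim (f≢0 refl)
  digit⇒encodes e d@(old _)      _ = labeled e d
  digit⇒encodes e d@(recent _ _) _ = labeled e d

  ⊕true-Γ : ∀ {K φ i l f} → Encodes K φ i l → (l ⊕ true) ≡ just f → Γ I K φ i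
  ⊕true-Γ (free _ γ) _ = γ
  ⊕true-Γ (labeled {f = zero} _ d) _ = ⊥-elim (digit-just-nonzero d refl)
  ⊕true-Γ (labeled {f = suc zero} _ _) ()
  ⊕true-Γ (labeled {f = suc (suc _)} _ _) ()

  neighbourConflict? : ∀ K (φ : PartialLabeling n) v w →
    Dec (∃[ x ] (adj v w ≡ true × φ w ≡ just x × (suc K ∸ x) ∈ t v w))
  neighbourConflict? K φ v w with adj v w | φ w
  ... | false | _      = no λ ()
  ... | true  | nothing = no λ ()
  ... | true  | just y  =
    map′ (λ mem → y , refl , refl , mem) (λ { (_ , _ , refl , mem) → mem }) (suc K ∸ y ∈? t v w)

  Γ? : ∀ K (φ : PartialLabeling n) i → Dec (Γ I K φ i)
  Γ? K φ i = (suc K ∈? Λ i) ×-dec ¬? (any? (neighbourConflict? K φ i))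

  unlabeled-letter : ∀ {K φ i} → φ i ≡ nothing → ∃[ l ] (Encodes K φ i l × (l ⊕ false) ≡ just zero)
  unlabeled-letter {K} {φ} {i} e with Γ? K φ i
  ... | yes γ  = num zero , free e γ , refl
  ... | no ¬γ = bar0 , blocked e ¬γ , refl

  Conflict : Vec (Fin (suc (suc τ))) n → Fin n → Set
  Conflict b i = ∃[ j ] (adj i j ≡ true × ((τ + 2) ∸ toℕ (lookup b j)) ∈ t i j)

  conflict? : ∀ b i → Dec (Conflict b i)
  conflict? b i = any? (λ j → (adj i j Bool.≟ true) ×-dec (((τ + 2) ∸ toℕ (lookup b j)) ∈? t i j))

module Window {n : ℕ} (I : Instance n) (τ : ℕ) (bounded : Bounded τ I) (k : ℕ) where
  open Instance I
  open Encoding I τ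

  private
    beyond-bound : ∀ {i w d} → adj i w ≡ true → τ < d → d ∉ t i w
    beyond-bound ad τ<d mem = <⇒≱ τ<d (bounded _ _ ad _ mem)

    recent-difference : ∀ {x a} → x + τ + 1 ≡ suc k + a → (τ + 2) ∸ a ≡ suc (suc k) ∸ x
    recent-difference {x} {a} eq = begin
      (τ + 2) ∸ a                 ≡⟨ [m+n]∸[m+o]≡n∸o x (τ + 2) a ⟨
      (x + (τ + 2)) ∸ (x + a)     ≡⟨ cong₂ _∸_ shifted (+-comm x a) ⟩
      (a + suc (suc k)) ∸ (a + x) ≡⟨ [m+n]∸[m+o]≡n∸o a (suc (suc k)) x ⟩
      suc (suc k) ∸ x             ∎
      where
      open ≡-Reasoning
      shifted : x + (τ + 2) ≡ a + suc (suc k)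
      shifted = begin
        x + (τ + 2)      ≡⟨ +-assoc x τ 2 ⟨
        x + τ + 2        ≡⟨ +-suc (x + τ) 1 ⟩
        suc (x + τ + 1)  ≡⟨ cong suc eq ⟩
        suc (suc k) + a  ≡⟨ +-comm (suc (suc k)) a ⟩
        a + suc (suc k)  ∎

  -- Missing and old labels give differences above τ, hence never conflict.
  digit-conflict : ∀ {i w m f} → adj i w ≡ true → Digit (suc k) m f →
    ((τ + 2) ∸ toℕ f) ∈ t i w ⇔ (∃[ x ] (m ≡ just x × (suc (suc k) ∸ x) ∈ t i w))
  digit-conflict ad unlabeled =
    mk⇔ (λ mem → ⊥-elim (beyond-bound ad (m<m+n τ (s≤s z≤n)) mem)) (λ ())
  digit-conflict {i} {w} ad (old {x} x+τ≤1+k) = mk⇔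
    (λ mem → ⊥-elim (beyond-bound ad (m<m+n τ (s≤s z≤n))
                       (subst (_∈ t i w) (+-∸-assoc τ (s≤s z≤n)) mem)))
    (λ { (_ , refl , mem) → ⊥-elim (beyond-bound ad far mem) })
    where
    far : τ < suc (suc k) ∸ x
    far = m+n≤o⇒m≤o∸n (suc τ) (s≤s (subst (_≤ suc k) (+-comm x τ) x+τ≤1+k))
  digit-conflict {i} {w} ad (recent _ eq) = mk⇔
    (λ mem → _ , refl , subst (_∈ t i w) (recent-difference eq) mem)
    (λ { (_ , refl , mem) → subst (_∈ t i w) (sym (recent-difference eq)) mem })

  Γ⇔noConflict : ∀ {ψ b i} → (∀ w → Digit (suc k) (ψ w) (lookup b w)) →
    Γ I (suc k) ψ i ⇔ (suc (suc k) ∈ Λ i × ¬ Conflict b i)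
  Γ⇔noConflict {ψ} {b} {i} digits = mk⇔
    (λ (lam , ¬c) → lam , ¬c ∘ conflicting-label)
    (λ (lam , ¬c) → lam , ¬c ∘ conflicting-digit)
    where
    ConflictingLabel : Set
    ConflictingLabel = ∃[ w ] ∃[ x ] (adj i w ≡ true × ψ w ≡ just x × (suc (suc k) ∸ x) ∈ t i w)

    conflicting-digit : ConflictingLabel → Conflict b i
    conflicting-digit (w , x , ad , e , mem) = w , ad , from (digit-conflict ad (digits w)) (x , e , mem)

    conflicting-label : Conflict b i → ConflictingLabel
    conflicting-label (w , ad , mem) =
      let (x , e , mem′) = to (digit-conflict ad (digits w)) mem in w , x , ad , e , mem′

  BarCase : Vec (Fin (suc (suc τ))) n → Fin n → Letter τ → Set
  BarCase b i l =
      (lookup b i ≡ zero × suc (suc k) ∈ Λ i × ¬ Conflict b i × l ≡ num zero)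
    ⊎ (lookup b i ≡ zero × (suc (suc k) ∉ Λ i ⊎ Conflict b i) × l ≡ bar0)
    ⊎ (lookup b i ≢ zero × l ≡ num (lookup b i))

  barCase⇔encodes : ∀ {ψ b} → (∀ w → Digit (suc k) (ψ w) (lookup b w)) →
    ∀ i {l} → BarCase b i l ⇔ Encodes (suc k) ψ i l
  barCase⇔encodes {ψ} {b} digits i = mk⇔ barCase⇒encodes encodes⇒barCase
    where
    Γ⇔ : Γ I (suc k) ψ i ⇔ (suc (suc k) ∈ Λ i × ¬ Conflict b i)
    Γ⇔ = Γ⇔noConflict {b = b} digits

    blocking-reason : ¬ Γ I (suc k) ψ i → suc (suc k) ∉ Λ i ⊎ Conflict b i
    blocking-reason ¬γ with suc (suc k) ∈? Λ i | conflict? b i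
    ... | no ¬lam | _     = inj₁ ¬lam
    ... | yes _   | yes c = inj₂ c
    ... | yes lam | no ¬c = ⊥-elim (¬γ (from Γ⇔ (lam , ¬c)))

    barCase⇒encodes : ∀ {l} → BarCase b i l → Encodes (suc k) ψ i l
    barCase⇒encodes (inj₁ (b≡0 , lam , ¬c , refl)) =
      free (digit-zero⇒unlabeled (digits i) b≡0) (from Γ⇔ (lam , ¬c))
    barCase⇒encodes (inj₂ (inj₁ (b≡0 , reason , refl))) =
      blocked (digit-zero⇒unlabeled (digits i) b≡0)
        λ γ → let (lam , ¬c) = to Γ⇔ γ in [ (λ ¬lam → ¬lam lam) , ¬c ] reason
    barCase⇒encodes (inj₂ (inj₂ (b≢0 , refl))) = digit⇒encodes refl (digits i) b≢0

    encodes⇒barCase : ∀ {l} → Encodes (suc k) ψ i l → BarCase b i l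
    encodes⇒barCase (free e γ) =
      let (lam , ¬c) = to Γ⇔ γ in inj₁ (unlabeled⇒digit-zero e (digits i) , lam , ¬c , refl)
    encodes⇒barCase (blocked e ¬γ) =
      inj₂ (inj₁ (unlabeled⇒digit-zero e (digits i) , blocking-reason ¬γ , refl))
    encodes⇒barCase (labeled {f = f} e d) =
      inj₂ (inj₂ (digit-just-nonzero d ∘ trans (sym b≡f) , cong num (sym b≡f)))
      where
      b≡f : lookup b i ≡ f
      b≡f = digit-functional (subst (λ m → Digit (suc k) m (lookup b i)) e (digits i)) d

-- τ ≥ 1 is needed here: only then is the digit τ + 1 given to a new label k + 1 a recent one.
module Step {n : ℕ} (I : Instance n) (τ′ : ℕ) (bounded : Bounded (suc τ′) I) (k : ℕ) where
  open Instance I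

  τ : ℕ
  τ = suc τ′

  open Encoding I τ
  open Window I τ bounded k

  newest-digit : Digit (suc k) (just (suc k)) (fromℕ (suc τ))
  newest-digit = recent (s≤s (s≤s z≤n)) (begin
    suc k + τ + 1                 ≡⟨ +-assoc (suc k) τ 1 ⟩
    suc k + (τ + 1)               ≡⟨ cong (suc k +_) (+-comm τ 1) ⟩
    suc k + suc τ                 ≡⟨ cong (suc k +_) (toℕ-fromℕ (suc τ)) ⟨
    suc k + toℕ (fromℕ (suc τ))   ∎)
    where open ≡-Reasoning

  shift-digit : ∀ {x g f} → Digit k (just x) g → (num g ⊕ false) ≡ just f → Digit (suc k) (just x) f
  shift-digit (old x+τ≤k) refl = old (m≤n⇒m≤1+n x+τ≤k)
  shift-digit (recent {j = zero} () _) _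
  shift-digit (recent {j = suc zero} (s≤s ()) _) _
  shift-digit (recent {x} {j = suc (suc zero)} _ eq) refl =
    old (≤-reflexive (suc-injective (trans (+-comm 1 (x + τ)) (trans eq (+-comm k 2)))))
  shift-digit (recent {j = suc (suc (suc m))} _ eq) refl = recent (s≤s (s≤s z≤n))
    (trans eq (trans (+-suc k _) (sym (cong (λ z → suc k + suc (suc z)) (toℕ-inject₁ m)))))

  unshift-digit : ∀ {x f} → Digit (suc k) (just x) f → x ≢ suc k →
    ∃[ g ] (Digit k (just x) g × (num g ⊕ false) ≡ just f)
  unshift-digit (old {x} x+τ≤1+k) _ with x + τ ≤? k
  ... | yes x+τ≤k = suc zero , old x+τ≤k , refl
  ... | no  x+τ≰k = suc (suc zero) , recent (s≤s (s≤s z≤n)) eq , refl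
    where
    eq : x + τ + 1 ≡ k + 2
    eq = trans (cong (_+ 1) (≤-antisym x+τ≤1+k (≰⇒> x+τ≰k))) (sym (+-suc k 1))
  unshift-digit (recent {j = zero} () _) _
  unshift-digit (recent {j = suc zero} (s≤s ()) _) _
  unshift-digit (recent {x} {j = suc (suc m)} _ eq) x≢1+k =
    suc (suc (suc (lower₁ m m≢last))) , recent (s≤s (s≤s z≤n)) eq′ ,
    cong (λ (g : Fin τ) → just (suc (suc g))) (inject₁-lower₁ m m≢last)
    where
    m≢last : τ′ ≢ toℕ m
    m≢last τ′≡m = x≢1+k (+-cancelʳ-≡ (τ + 1) x (suc k) (begin
      x + (τ + 1)        ≡⟨ +-assoc x τ 1 ⟨
      x + τ + 1          ≡⟨ eq ⟩
      suc k + suc (suc (toℕ m)) ≡⟨ cong (λ z → suc k + suc (suc z)) τ′≡m ⟨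
      suc k + suc τ      ≡⟨ cong (suc k +_) (+-comm 1 τ) ⟩
      suc k + (τ + 1)    ∎))
      where open ≡-Reasoning

    eq′ : x + τ + 1 ≡ k + suc (suc (suc (toℕ (lower₁ m m≢last))))
    eq′ = trans eq (trans (sym (+-suc k _))
            (sym (cong (λ z → k + suc (suc (suc z))) (toℕ-lower₁ m m≢last))))

  extend : Bool → Maybe ℕ → Maybe ℕ
  extend true  _ = just (suc k)
  extend false m = m

  extension : Vec Bool n → PartialLabeling n → PartialLabeling n
  extension p φ i = extend (lookup p i) (φ i)

  extend-just : ∀ {bo m x} → extend bo m ≡ just x → (bo ≡ true × x ≡ suc k) ⊎ (bo ≡ false × m ≡ just x)
  extend-just {true}  refl = inj₁ (refl , refl)
  extend-just {false} e    = inj₂ (refl , e)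

  ⊕-extend-digit : ∀ {φ i l bo f} → Encodes k φ i l → (l ⊕ bo) ≡ just f →
    Digit (suc k) (extend bo (φ i)) f
  ⊕-extend-digit {bo = true}  (free _ _)    refl = newest-digit
  ⊕-extend-digit {bo = true}  (labeled {f = zero} _ d) _ = ⊥-elim (digit-just-nonzero d refl)
  ⊕-extend-digit {bo = true}  (labeled {f = suc zero} _ _) ()
  ⊕-extend-digit {bo = true}  (labeled {f = suc (suc _)} _ _) ()
  ⊕-extend-digit {bo = false} (free e _)    refl rewrite e = unlabeled
  ⊕-extend-digit {bo = false} (blocked e _) refl rewrite e = unlabeled
  ⊕-extend-digit {bo = false} (labeled e d) eq   rewrite e = shift-digit d eq

  extension-values : ∀ {φ} p → ValuesIn I k φ → ValuesIn I (suc k) (extension p φ)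
  extension-values p Vφ i x e with extend-just e
  ... | inj₁ (_ , refl) = s≤s z≤n , ≤-refl
  ... | inj₂ (_ , e′)   = let (1≤x , x≤k) = Vφ i x e′ in 1≤x , m≤n⇒m≤1+n x≤k

  newest-compatible : ∀ {φ i j y} → ValuesIn I k φ → Γ I k φ i → adj i j ≡ true → φ j ≡ just y →
    ∣ suc k - y ∣ ∉ t i j
  newest-compatible {j = j} {y} Vφ (_ , no-conflict) ad e mem =
    no-conflict (j , y , ad , e , subst (_∈ _) (m≤n⇒∣n-m∣≡n∸m (m≤n⇒m≤1+n (proj₂ (Vφ j y e)))) mem)

  extension-proper : ∀ {φ p} → Proper I φ → ValuesIn I k φ → P I τ p →
    (∀ i → lookup p i ≡ true → Γ I k φ i) → Proper I (extension p φ)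
  extension-proper {φ} {p} (Λφ , Eφ) Vφ independent new-Γ = labels , edges
    where
    labels : ∀ i x → extension p φ i ≡ just x → x ∈ Λ i
    labels i x e with extend-just e
    ... | inj₁ (pᵢ , refl) = proj₁ (new-Γ i pᵢ)
    ... | inj₂ (_ , e′)    = Λφ i x e′

    edges : ∀ i j x y → adj i j ≡ true → extension p φ i ≡ just x → extension p φ j ≡ just y →
      ∣ x - y ∣ ∉ t i j
    edges i j x y ad eᵢ eⱼ with extend-just eᵢ | extend-just eⱼ
    ... | inj₁ (pᵢ , refl) | inj₁ (pⱼ , refl) = λ _ → independent i j ad pᵢ pⱼ
    ... | inj₁ (pᵢ , refl) | inj₂ (_ , eⱼ′)   = newest-compatible Vφ (new-Γ i pᵢ) ad eⱼ′
    ... | inj₂ (_ , eᵢ′)   | inj₁ (pⱼ , refl) =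
      newest-compatible Vφ (new-Γ j pⱼ) (trans (adj-sym j i) ad) eᵢ′ ∘ subst₂ _∈_ (∣-∣-comm x y) (t-sym i j)
    ... | inj₂ (_ , eᵢ′)   | inj₂ (_ , eⱼ′)   = Eφ i j x y ad eᵢ′ eⱼ′

  T⊕P⇒T : ∀ {c} → Bar I τ k (T I τ k ⊕ˢ P I τ) c → T I τ (suc k) c
  T⊕P⇒T {c} (b , (a , p , Ta , independent , a⊕p≡b) , isBar) =
    from (T⇔Encoded {a = c}) (extended (to (T⇔Encoded {a = a}) Ta))
    where
    extended : Encoded k a → Encoded (suc k) c
    extended (φ , Pφ , Vφ , enc) =
      extension p φ , extension-proper {p = p} Pφ Vφ independent new-Γ , extension-values p Vφ ,
      λ i → to (barCase⇔encodes {b = b} digits i) (isBar i)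
      where
      digits : ∀ w → Digit (suc k) (extension p φ w) (lookup b w)
      digits w = ⊕-extend-digit (enc w) (a⊕p≡b w)

      new-Γ : ∀ i → lookup p i ≡ true → Γ I k φ i
      new-Γ i pᵢ =
        ⊕true-Γ (enc i) (subst (λ bo → (lookup a i ⊕ bo) ≡ just (lookup b i)) pᵢ (a⊕p≡b i))

  isNewest : Maybe ℕ → Bool
  isNewest nothing = false
  isNewest (just x) with x ≟ suc k
  ... | yes _ = true
  ... | no  _ = false

  restrict : Maybe ℕ → Maybe ℕ
  restrict m = if isNewest m then nothing else m

  newest-cases : ∀ m → (m ≡ just (suc k) × isNewest m ≡ true × restrict m ≡ nothing)
                     ⊎ (m ≢ just (suc k) × isNewest m ≡ false × restrict m ≡ m)
  newest-cases nothing = inj₂ ((λ ()) , refl , refl)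
  newest-cases (just x) with x ≟ suc k
  ... | yes refl  = inj₁ (refl , refl , refl)
  ... | no x≢1+k = inj₂ (x≢1+k ∘ just-injective , refl , refl)

  restrict-just : ∀ {m x} → restrict m ≡ just x → m ≡ just x × x ≢ suc k
  restrict-just {m} e with newest-cases m
  ... | inj₁ (_ , _ , erased)   = case trans (sym erased) e of λ ()
  ... | inj₂ (¬new , _ , kept) = trans (sym kept) e , λ { refl → ¬new (trans (sym kept) e) }

  isNewest-true : ∀ {m} → isNewest m ≡ true → m ≡ just (suc k)
  isNewest-true {m} e with newest-cases m
  ... | inj₁ (new , _ , _)   = new
  ... | inj₂ (_ , older , _) = case trans (sym older) e of λ ()

  restriction-proper : ∀ {ψ} → Proper I ψ → Proper I (restrict ∘ ψ)
  restriction-proper (Λψ , Eψ) =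
    (λ i x e → Λψ i x (proj₁ (restrict-just e))) ,
    (λ i j x y ad eᵢ eⱼ → Eψ i j x y ad (proj₁ (restrict-just eᵢ)) (proj₁ (restrict-just eⱼ)))

  restriction-values : ∀ {ψ} → ValuesIn I (suc k) ψ → ValuesIn I k (restrict ∘ ψ)
  restriction-values Vψ i x e =
    let (eψ , x≢1+k) = restrict-just e
        (1≤x , x≤1+k) = Vψ i x eψ
    in 1≤x , m<1+n⇒m≤n (≤∧≢⇒< x≤1+k x≢1+k)

  restriction-Γ : ∀ {ψ i} → Proper I ψ → ValuesIn I (suc k) ψ → ψ i ≡ just (suc k) → Γ I k (restrict ∘ ψ) i
  restriction-Γ {ψ} {i} (Λψ , Eψ) Vψ e = Λψ i (suc k) e , λ (w , y , ad , eφ , mem) →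
    let (eψ , _) = restrict-just eφ in
    Eψ i w (suc k) y ad e eψ (subst (_∈ t i w) (sym (m≤n⇒∣n-m∣≡n∸m (proj₂ (Vψ w y eψ)))) mem)

  newest-independent : ∀ {ψ} → Proper I ψ → P I τ (tabulate (isNewest ∘ ψ))
  newest-independent {ψ} (_ , Eψ) i j ad pᵢ pⱼ =
    Eψ i j (suc k) (suc k) ad (newest i pᵢ) (newest j pⱼ)
      (subst (_∈ t i j) (sym (∣n-n∣≡0 (suc k))) (t-zero i j ad))
    where
    newest : ∀ i → lookup (tabulate (isNewest ∘ ψ)) i ≡ true → ψ i ≡ just (suc k)
    newest i pᵢ = isNewest-true (trans (sym (lookup∘tabulate (isNewest ∘ ψ) i)) pᵢ)

  unshift-encodes : ∀ {ψ i l} → Proper I ψ → ValuesIn I (suc k) ψ → Encodes (suc k) ψ i l →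
    ∃[ l′ ] (Encodes k (restrict ∘ ψ) i l′ × (l′ ⊕ isNewest (ψ i)) ≡ just (digitOf l))
  unshift-encodes {ψ} {i} {l} Pψ Vψ enc with newest-cases (ψ i)
  ... | inj₁ (new , newest , erased) =
    num zero , free erased (restriction-Γ Pψ Vψ new) ,
    subst (λ bo → (num zero ⊕ bo) ≡ just (digitOf l)) (sym newest) (cong just newest≡digit)
    where
    newest≡digit : fromℕ (suc τ) ≡ digitOf l
    newest≡digit = digit-functional newest-digit
      (subst (λ m → Digit (suc k) m (digitOf l)) new (encodes⇒digit enc))
  ... | inj₂ (¬new , older , kept) =
    let (l′ , enc′ , l′⊕0≡f) = unshift-older enc in
    l′ , enc′ , subst (λ bo → (l′ ⊕ bo) ≡ just (digitOf l)) (sym older) l′⊕0≡f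
    where
    unshift-older : ∀ {l} → Encodes (suc k) ψ i l →
      ∃[ l′ ] (Encodes k (restrict ∘ ψ) i l′ × (l′ ⊕ false) ≡ just (digitOf l))
    unshift-older (free e _)    = unlabeled-letter (trans kept e)
    unshift-older (blocked e _) = unlabeled-letter (trans kept e)
    unshift-older (labeled e d) =
      let (g , d′ , g⊕0≡f) = unshift-digit d (λ { refl → ¬new e }) in
      num g , labeled (trans kept e) d′ , g⊕0≡f

  T⇒T⊕P : ∀ {c} → T I τ (suc k) c → Bar I τ k (T I τ k ⊕ˢ P I τ) c
  T⇒T⊕P {c} Tc = restricted (to (T⇔Encoded {a = c}) Tc)
    where
    restricted : Encoded (suc k) c → Bar I τ k (T I τ k ⊕ˢ P I τ) c
    restricted (ψ , Pψ , Vψ , enc) =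
      b , (a , p , Ta , newest-independent Pψ , a⊕p≡b) ,
      λ i → from (barCase⇔encodes {b = b} digits i) (enc i)
      where
      letter : ∀ i →
        ∃[ l′ ] (Encodes k (restrict ∘ ψ) i l′ × (l′ ⊕ isNewest (ψ i)) ≡ just (digitOf (lookup c i)))
      letter i = unshift-encodes Pψ Vψ (enc i)

      a : Vec (Letter τ) n
      a = tabulate (proj₁ ∘ letter)
      p : Vec Bool n
      p = tabulate (isNewest ∘ ψ)
      b : Vec (Fin (suc (suc τ))) n
      b = tabulate (digitOf ∘ lookup c)

      encodes-a : ∀ i → Encodes k (restrict ∘ ψ) i (lookup a i)
      encodes-a i rewrite lookup∘tabulate (proj₁ ∘ letter) i = proj₁ (proj₂ (letter i))

      Ta : T I τ k a
      Ta = from (T⇔Encoded {a = a})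
        (restrict ∘ ψ , restriction-proper Pψ , restriction-values Vψ , encodes-a)

      a⊕p≡b : ∀ i → (lookup a i ⊕ lookup p i) ≡ just (lookup b i)
      a⊕p≡b i rewrite lookup∘tabulate (proj₁ ∘ letter) i | lookup∘tabulate (isNewest ∘ ψ) i
                    | lookup∘tabulate (digitOf ∘ lookup c) i = proj₂ (proj₂ (letter i))

      digits : ∀ w → Digit (suc k) (ψ w) (lookup b w)
      digits w rewrite lookup∘tabulate (digitOf ∘ lookup c) w = encodes⇒digit (enc w)

mainTheorem1 : ∀ (n τ : ℕ) (I : Instance n) → 1 ≤ τ → Bounded τ I →
    ∀ (k : ℕ) → 1 ≤ k → ∀ (c : Vec (Letter τ) n) →
    Bar I τ k (T I τ k ⊕ˢ P I τ) c ⇔ T I τ (suc k) c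
mainTheorem1 n zero     I () bounded k _ c
mainTheorem1 n (suc τ′) I _ bounded k _ c = mk⇔ (T⊕P⇒T {c}) (T⇒T⊕P {c})
  where open Step I τ′ bounded k
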